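{- Let $M$ and $N$ be matroids on disjoint finite sets $S$ and $T$, and let $A\subseteq S$, $B\subseteq T$. For $X\subseteq S$ and $Y\subseteq T$, the set $X\cup Y$ is cyclic in the principal sum $(M,N;A,B)$ if and only if either (1) $X$ is cyclic in $M$, $Y$ is cyclic in $N$, and $Y\cap B=\emptyset$; or (2) the only coloops of $M|(X\cup A)$ are in $A$, $Y$ is cyclic in $N$, and $r_M(X\cup A)+r_N(Y)<r_M(X)+r_N(Y-B)+|Y\cap B|$.
   Context: A set in a matroid is cyclic if it is a (possibly empty) union of circuits. The principal sum $(M,N;A,B)$ is the matroid union $M^+(A,B)\vee N_0$, where: $N_0=N\oplus U_{0,S}$ ($N$ with the elements of $S$ added as loops); $M^+(A,B)$ is the matroid on $S\cup T$ obtained from $M$ by adding each element of $B$ freely (by successive principal extensions) to the flat $\mathrm{cl}_M(A)$ and each element of $T-B$ as a loop, equivalently the matroid with rank function $r(X\cup Y)=\min\{r_M(X\cup A),\,r_M(X)+|Y\cap B|\}$ for $X\subseteq S$, $Y\subseteq T$; and the matroid union $G\vee H$ of matroids on a common set has as independent sets the unions of an independent set of $G$ and an independent set of $H$. -}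

module Defs where

open import Data.Nat using (ℕ; _+_; _≤_; _<_; _⊓_)
open import Data.Fin using (Fin)
open import Data.Fin.Subset using (Subset; _∈_; _⊆_; _⊂_; _∪_; _∩_; _─_; ∣_∣; ⊥)
open import Data.Vec using (_++_)
open import Data.Product using (Σ; ∃; _×_; _,_)
open import Relation.Binary.PropositionalEquality using (_≡_)
open import Relation.Nullary using (¬_)

record Matroid (n : ℕ) : Set where
  field
    rank      : Subset n → ℕ
    rank-≤    : ∀ X → rank X ≤ ∣ X ∣
    rank-mono : ∀ X Y → X ⊆ Y → rank X ≤ rank Y
    rank-sub  : ∀ X Y → rank (X ∪ Y) + rank (X ∩ Y) ≤ rank X + rank Y
open Matroid public

Independent : ∀ {n} → Matroid n → Subset n → Set
Independent M X = rank M X ≡ ∣ X ∣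

IsCircuit : ∀ {n} → (Subset n → Set) → Subset n → Set
IsCircuit Ind C = ¬ Ind C × (∀ D → D ⊂ C → Ind D)

-- X is cyclic: X is a (possibly empty) union of circuits, i.e. every element
-- of X lies in some circuit contained in X.
Cyclic : ∀ {n} → (Subset n → Set) → Subset n → Set
Cyclic Ind X = ∀ e → e ∈ X → ∃ λ C → IsCircuit Ind C × e ∈ C × C ⊆ X

CyclicIn : ∀ {n} → Matroid n → Subset n → Set
CyclicIn M = Cyclic (Independent M)

IsBasisOfRestriction : ∀ {n} → Matroid n → Subset n → Subset n → Set
IsBasisOfRestriction M Z Bs =
  Bs ⊆ Z × Independent M Bs ×
  (∀ Bs′ → Bs ⊆ Bs′ → Bs′ ⊆ Z → Independent M Bs′ → Bs′ ≡ Bs)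

IsColoopOfRestriction : ∀ {n} → Matroid n → Subset n → Fin n → Set
IsColoopOfRestriction M Z e =
  e ∈ Z × (∀ Bs → IsBasisOfRestriction M Z Bs → e ∈ Bs)

-- Ground set S ∪ T is modelled as Fin (s + t): the first s elements are S,
-- the last t are T; X ∪ Y (X ⊆ S, Y ⊆ T) is X ++ Y.

rankM⁺ : ∀ {s t} → Matroid s → Subset s → Subset t →
         Subset s → Subset t → ℕ
rankM⁺ M A B X Y = rank M (X ∪ A) ⊓ (rank M X + ∣ Y ∩ B ∣)

IndependentM⁺ : ∀ {s t} → Matroid s → Subset s → Subset t →
                Subset s → Subset t → Set
IndependentM⁺ M A B X Y = rankM⁺ M A B X Y ≡ ∣ X ∣ + ∣ Y ∣

-- Independence in N₀ = N ⊕ U_{0,S}: no elements of S, independent in N on T.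
IndependentN₀ : ∀ {s t} → Matroid t → Subset s → Subset t → Set
IndependentN₀ N X Y = X ≡ ⊥ × Independent N Y

-- Independent sets of the principal sum (M,N;A,B) = M⁺(A,B) ∨ N₀.
IndependentPrincipalSum : ∀ {s t} → Matroid s → Matroid t →
                          Subset s → Subset t → Subset (s + t) → Set
IndependentPrincipalSum {s} {t} M N A B Z =
  Σ (Subset s) λ X₁ → Σ (Subset t) λ Y₁ →
  Σ (Subset s) λ X₂ → Σ (Subset t) λ Y₂ →
    IndependentM⁺ M A B X₁ Y₁ × IndependentN₀ N X₂ Y₂ ×
    Z ≡ (X₁ ∪ X₂) ++ (Y₁ ∪ Y₂)

-- The principal sum is a matroid P on S ∪ T whose rank on X ∪ Y (X ⊆ S,
-- Y ⊆ T) is ρ X Y = min (ρ₁ X Y) (ρ₂ X Y), where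
--   ρ₁ X Y = r_M(X) + r_N(Y ─ B) + ∣ Y ∩ B ∣   (the rank of M ⊕ Nᶠ, with Nᶠ the
--            matroid N in which the elements of B are made coloops), and
--   ρ₂ X Y = r_M(X ∪ A) + r_N(Y).
-- Both are submodular and ρ₁ - ρ₂ grows along inclusions, so ρ is submodular;
-- its independent sets are shown to be exactly the unions of an independent
-- set of M⁺(A,B) and one of N₀.  In any matroid a set is cyclic iff deleting
-- any one of its elements keeps its rank, so X ∪ Y is cyclic iff ρ is stable
-- under deleting one element of X or of Y.  If ρ₁ ≤ ρ₂ this forces ρ₁ to be
-- stable, which is alternative (1); if ρ₂ < ρ₁ it forces ρ₂ to be stable,
-- which is alternative (2), because r_M(X ∪ A) survives the deletion of every
-- element of X exactly when all coloops of M|(X ∪ A) lie in A.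
module Submission where

open import Defs
open import Data.Nat using (ℕ; zero; suc; _+_; _≤_; _<_; _⊓_; z≤n; _≟_; _<?_)
open import Data.Nat.Properties
open import Data.Fin using (Fin; _↑ˡ_; _↑ʳ_)
open import Data.Fin.Properties using (splitAt⁻¹-↑ˡ; splitAt⁻¹-↑ʳ; any?)
import Data.Fin as Fin
open import Data.Fin.Subset
open import Data.Fin.Subset.Properties
open import Data.Bool using (_∨_; _∧_)
open import Data.Vec using (_∷_; []; there; _++_; take; drop)
open import Data.Vec.Properties
  using (take++drop≡id; ++-injectiveˡ; ++-injectiveʳ; take-zipWith; drop-zipWith;
         zipWith-++; lookup-++ˡ; lookup-++ʳ; []=⇒lookup; lookup⇒[]=)
open import Data.Product using (∃; _×_; _,_; proj₁; proj₂)
open import Data.Sum using (_⊎_; inj₁; inj₂)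
open import Relation.Nullary using (¬_; Dec; yes; no; contradiction)
open import Function.Base using (_∘_)
open import Relation.Nullary.Decidable using (_×-dec_; ¬?)
open import Relation.Binary.PropositionalEquality
open import Function.Bundles using (_⇔_; mk⇔; Equivalence)
open import Function.Properties.Equivalence using () renaming (sym to ⇔-sym; trans to ⇔-trans)
open import Algebra.Properties.CommutativeSemigroup +-commutativeSemigroup using (interchange)
open import Data.Nat.Tactic.RingSolver using (solve-∀)

private variable n : ℕ

x∈p─q⇒x∉q : ∀ {x : Fin n} p q → x ∈ p ─ q → x ∉ q
x∈p─q⇒x∉q (outside ∷ p) (outside ∷ q) (there x∈) (there x∈q) = x∈p─q⇒x∉q p q x∈ x∈q
x∈p─q⇒x∉q (outside ∷ p) (inside  ∷ q) (there x∈) (there x∈q) = x∈p─q⇒x∉q p q x∈ x∈q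
x∈p─q⇒x∉q (inside  ∷ p) (outside ∷ q) (there x∈) (there x∈q) = x∈p─q⇒x∉q p q x∈ x∈q
x∈p─q⇒x∉q (inside  ∷ p) (inside  ∷ q) (there x∈) (there x∈q) = x∈p─q⇒x∉q p q x∈ x∈q

∣p∩q∣+∣p─q∣≡∣p∣ : ∀ (p q : Subset n) → ∣ p ∩ q ∣ + ∣ p ─ q ∣ ≡ ∣ p ∣
∣p∩q∣+∣p─q∣≡∣p∣ []            []            = refl
∣p∩q∣+∣p─q∣≡∣p∣ (outside ∷ p) (outside ∷ q) = ∣p∩q∣+∣p─q∣≡∣p∣ p q
∣p∩q∣+∣p─q∣≡∣p∣ (outside ∷ p) (inside  ∷ q) = ∣p∩q∣+∣p─q∣≡∣p∣ p q
∣p∩q∣+∣p─q∣≡∣p∣ (inside  ∷ p) (outside ∷ q) = trans (+-suc _ _) (cong suc (∣p∩q∣+∣p─q∣≡∣p∣ p q))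
∣p∩q∣+∣p─q∣≡∣p∣ (inside  ∷ p) (inside  ∷ q) = cong suc (∣p∩q∣+∣p─q∣≡∣p∣ p q)

∣p∪q∣+∣p∩q∣≡∣p∣+∣q∣ : ∀ (p q : Subset n) → ∣ p ∪ q ∣ + ∣ p ∩ q ∣ ≡ ∣ p ∣ + ∣ q ∣
∣p∪q∣+∣p∩q∣≡∣p∣+∣q∣ []            []            = refl
∣p∪q∣+∣p∩q∣≡∣p∣+∣q∣ (outside ∷ p) (outside ∷ q) = ∣p∪q∣+∣p∩q∣≡∣p∣+∣q∣ p q
∣p∪q∣+∣p∩q∣≡∣p∣+∣q∣ (outside ∷ p) (inside  ∷ q) =
  trans (cong suc (∣p∪q∣+∣p∩q∣≡∣p∣+∣q∣ p q)) (sym (+-suc _ _))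
∣p∪q∣+∣p∩q∣≡∣p∣+∣q∣ (inside  ∷ p) (outside ∷ q) = cong suc (∣p∪q∣+∣p∩q∣≡∣p∣+∣q∣ p q)
∣p∪q∣+∣p∩q∣≡∣p∣+∣q∣ (inside  ∷ p) (inside  ∷ q) =
  cong suc (trans (+-suc _ _) (trans (cong suc (∣p∪q∣+∣p∩q∣≡∣p∣+∣q∣ p q)) (sym (+-suc _ _))))

∣p∪q∣≤∣p∣+∣q∣ : ∀ (p q : Subset n) → ∣ p ∪ q ∣ ≤ ∣ p ∣ + ∣ q ∣
∣p∪q∣≤∣p∣+∣q∣ p q = ≤-trans (m≤m+n _ _) (≤-reflexive (∣p∪q∣+∣p∩q∣≡∣p∣+∣q∣ p q))

∣q∣+∣p─q∣≡∣p∣ : ∀ {p q : Subset n} → q ⊆ p → ∣ q ∣ + ∣ p ─ q ∣ ≡ ∣ p ∣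
∣q∣+∣p─q∣≡∣p∣ {p = p} {q} q⊆p =
  trans (cong (λ r → ∣ r ∣ + ∣ p ─ q ∣) (sym p∩q≡q)) (∣p∩q∣+∣p─q∣≡∣p∣ p q)
  where
  p∩q≡q : p ∩ q ≡ q
  p∩q≡q = ⊆-antisym (p∩q⊆q p q) (λ x∈q → x∈p∩q⁺ (q⊆p x∈q , x∈q))

x∈p⇒⁅x⁆⊆p : ∀ {x : Fin n} {p} → x ∈ p → ⁅ x ⁆ ⊆ p
x∈p⇒⁅x⁆⊆p {x = x} {p} x∈p y∈⁅x⁆ = subst (_∈ p) (sym (x∈⁅y⁆⇒x≡y x y∈⁅x⁆)) x∈p

1+∣p-x∣≡∣p∣ : ∀ {x : Fin n} {p} → x ∈ p → suc ∣ p - x ∣ ≡ ∣ p ∣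
1+∣p-x∣≡∣p∣ {x = x} {p} x∈p =
  trans (cong (_+ ∣ p - x ∣) (sym (∣⁅x⁆∣≡1 x))) (∣q∣+∣p─q∣≡∣p∣ (x∈p⇒⁅x⁆⊆p x∈p))

∣p∪⁅x⁆∣≡1+∣p∣ : ∀ {x : Fin n} {p} → x ∉ p → ∣ p ∪ ⁅ x ⁆ ∣ ≡ suc ∣ p ∣
∣p∪⁅x⁆∣≡1+∣p∣ {n} {x} {p} x∉p = begin
  ∣ p ∪ ⁅ x ⁆ ∣                  ≡⟨ sym (+-identityʳ _) ⟩
  ∣ p ∪ ⁅ x ⁆ ∣ + 0              ≡⟨ cong (∣ p ∪ ⁅ x ⁆ ∣ +_) (sym ∣p∩⁅x⁆∣≡0) ⟩
  ∣ p ∪ ⁅ x ⁆ ∣ + ∣ p ∩ ⁅ x ⁆ ∣  ≡⟨ ∣p∪q∣+∣p∩q∣≡∣p∣+∣q∣ p ⁅ x ⁆ ⟩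
  ∣ p ∣ + ∣ ⁅ x ⁆ ∣              ≡⟨ cong (∣ p ∣ +_) (∣⁅x⁆∣≡1 x) ⟩
  ∣ p ∣ + 1                      ≡⟨ +-comm ∣ p ∣ 1 ⟩
  suc ∣ p ∣                      ∎
  where
  open ≡-Reasoning
  disjoint : Empty (p ∩ ⁅ x ⁆)
  disjoint (y , y∈) with x∈p∩q⁻ p ⁅ x ⁆ y∈
  ... | y∈p , y∈⁅x⁆ = x∉p (subst (_∈ p) (x∈⁅y⁆⇒x≡y x y∈⁅x⁆) y∈p)
  ∣p∩⁅x⁆∣≡0 : ∣ p ∩ ⁅ x ⁆ ∣ ≡ 0
  ∣p∩⁅x⁆∣≡0 = trans (cong ∣_∣ (Empty-unique disjoint)) (∣⊥∣≡0 n)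

∣p∣≡0⇒x∉p : ∀ {x : Fin n} {p} → ∣ p ∣ ≡ 0 → x ∉ p
∣p∣≡0⇒x∉p {x = x} {p} ∣p∣≡0 x∈p = n≮0 (subst (∣ p - x ∣ <_) ∣p∣≡0 (x∈p⇒∣p-x∣<∣p∣ x∈p))

⊆∧∣∣≥⇒≡ : ∀ {p q : Subset n} → p ⊆ q → ∣ q ∣ ≤ ∣ p ∣ → p ≡ q
⊆∧∣∣≥⇒≡ {p = p} {q} p⊆q ∣q∣≤∣p∣ = ⊆-antisym p⊆q q⊆p
  where
  ∣q─p∣≡0 : ∣ q ─ p ∣ ≡ 0
  ∣q─p∣≡0 = n≤0⇒n≡0 (+-cancelˡ-≤ ∣ p ∣ _ _ (begin
    ∣ p ∣ + ∣ q ─ p ∣  ≡⟨ ∣q∣+∣p─q∣≡∣p∣ p⊆q ⟩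
    ∣ q ∣              ≤⟨ ∣q∣≤∣p∣ ⟩
    ∣ p ∣              ≡⟨ +-identityʳ _ ⟨
    ∣ p ∣ + 0          ∎))
    where open ≤-Reasoning
  q⊆p : q ⊆ p
  q⊆p {x} x∈q with x ∈? p
  ... | yes x∈p = x∈p
  ... | no  x∉p = contradiction (x∈p∧x∉q⇒x∈p─q x∈q x∉p) (∣p∣≡0⇒x∉p ∣q─p∣≡0)

∪-lub : ∀ {p q r : Subset n} → p ⊆ r → q ⊆ r → p ∪ q ⊆ r
∪-lub {p = p} {q} p⊆r q⊆r x∈ with x∈p∪q⁻ p q x∈
... | inj₁ x∈p = p⊆r x∈p
... | inj₂ x∈q = q⊆r x∈q

∩-glb : ∀ {p q r : Subset n} → r ⊆ p → r ⊆ q → r ⊆ p ∩ q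
∩-glb r⊆p r⊆q x∈ = x∈p∩q⁺ (r⊆p x∈ , r⊆q x∈)

∪-mono : ∀ {p p′ q q′ : Subset n} → p ⊆ p′ → q ⊆ q′ → p ∪ q ⊆ p′ ∪ q′
∪-mono {p′ = p′} {q′ = q′} p⊆ q⊆ =
  ∪-lub (λ x∈ → p⊆p∪q q′ (p⊆ x∈)) (λ x∈ → q⊆p∪q p′ q′ (q⊆ x∈))

∩-mono : ∀ {p p′ q q′ : Subset n} → p ⊆ p′ → q ⊆ q′ → p ∩ q ⊆ p′ ∩ q′
∩-mono {p = p} {q = q} p⊆ q⊆ = ∩-glb (λ x∈ → p⊆ (p∩q⊆p p q x∈)) (λ x∈ → q⊆ (p∩q⊆q p q x∈))

─-monoˡ : ∀ {p p′ : Subset n} q → p ⊆ p′ → p ─ q ⊆ p′ ─ q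
─-monoˡ {p = p} q p⊆ x∈ = x∈p∧x∉q⇒x∈p─q (p⊆ (p─q⊆p p q x∈)) (x∈p─q⇒x∉q p q x∈)

p⊆q∪[p─q] : ∀ (p q : Subset n) → p ⊆ q ∪ (p ─ q)
p⊆q∪[p─q] p q {x} x∈p with x ∈? q
... | yes x∈q = x∈p∪q⁺ (inj₁ x∈q)
... | no  x∉q = x∈p∪q⁺ (inj₂ (x∈p∧x∉q⇒x∈p─q x∈p x∉q))

x∈p-y⇒x≢y : ∀ {x y : Fin n} p → x ∈ p - y → x ≢ y
x∈p-y⇒x≢y {y = y} p x∈ refl = x∈p─q⇒x∉q p ⁅ y ⁆ x∈ (x∈⁅x⁆ y)

p⊆[p-x]∪⁅x⁆ : ∀ (p : Subset n) x → p ⊆ (p - x) ∪ ⁅ x ⁆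
p⊆[p-x]∪⁅x⁆ p x {y} y∈p with y Fin.≟ x
... | yes refl = q⊆p∪q (p - x) ⁅ x ⁆ (x∈⁅x⁆ x)
... | no  y≢x  = p⊆p∪q ⁅ x ⁆ (x∈p∧x≢y⇒x∈p-y y∈p y≢x)

[p∪q]─r⊆[p─r]∪[q─r] : ∀ (p q r : Subset n) → (p ∪ q) ─ r ⊆ (p ─ r) ∪ (q ─ r)
[p∪q]─r⊆[p─r]∪[q─r] p q r x∈ with x∈p∪q⁻ p q (p─q⊆p (p ∪ q) r x∈)
... | inj₁ x∈p = p⊆p∪q (q ─ r) (x∈p∧x∉q⇒x∈p─q x∈p (x∈p─q⇒x∉q (p ∪ q) r x∈))
... | inj₂ x∈q = q⊆p∪q (p ─ r) (q ─ r) (x∈p∧x∉q⇒x∈p─q x∈q (x∈p─q⇒x∉q (p ∪ q) r x∈))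

∣p++q∣≡∣p∣+∣q∣ : ∀ {s t} (X : Subset s) (Y : Subset t) → ∣ X ++ Y ∣ ≡ ∣ X ∣ + ∣ Y ∣
∣p++q∣≡∣p∣+∣q∣ []            Y = refl
∣p++q∣≡∣p∣+∣q∣ (outside ∷ X) Y = ∣p++q∣≡∣p∣+∣q∣ X Y
∣p++q∣≡∣p∣+∣q∣ (inside  ∷ X) Y = cong suc (∣p++q∣≡∣p∣+∣q∣ X Y)

⊥++⊥ : ∀ s t → ⊥ {s} ++ ⊥ {t} ≡ ⊥
⊥++⊥ zero    t = refl
⊥++⊥ (suc s) t = cong (outside ∷_) (⊥++⊥ s t)

⁅↑ˡ⁆ : ∀ {s} t (i : Fin s) → ⁅ i ⁆ ++ ⊥ ≡ ⁅ i ↑ˡ t ⁆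
⁅↑ˡ⁆ {suc s} t Fin.zero    = cong (inside ∷_) (⊥++⊥ s t)
⁅↑ˡ⁆         t (Fin.suc i) = cong (outside ∷_) (⁅↑ˡ⁆ t i)

⁅↑ʳ⁆ : ∀ s {t} (j : Fin t) → ⊥ ++ ⁅ j ⁆ ≡ ⁅ s ↑ʳ j ⁆
⁅↑ʳ⁆ zero    j = refl
⁅↑ʳ⁆ (suc s) j = cong (outside ∷_) (⁅↑ʳ⁆ s j)

module Split {s t : ℕ} where

  ↑ˡ∈++⁺ : ∀ {X : Subset s} {Y : Subset t} {i} → i ∈ X → (i ↑ˡ t) ∈ X ++ Y
  ↑ˡ∈++⁺ {X} {Y} {i} i∈X = lookup⇒[]= (i ↑ˡ t) (X ++ Y) (trans (lookup-++ˡ X Y i) ([]=⇒lookup i∈X))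

  ↑ˡ∈++⁻ : ∀ {X : Subset s} {Y : Subset t} {i} → (i ↑ˡ t) ∈ X ++ Y → i ∈ X
  ↑ˡ∈++⁻ {X} {Y} {i} h = lookup⇒[]= i X (trans (sym (lookup-++ˡ X Y i)) ([]=⇒lookup h))

  ↑ʳ∈++⁺ : ∀ {X : Subset s} {Y : Subset t} {j} → j ∈ Y → (s ↑ʳ j) ∈ X ++ Y
  ↑ʳ∈++⁺ {X} {Y} {j} j∈Y = lookup⇒[]= (s ↑ʳ j) (X ++ Y) (trans (lookup-++ʳ X Y j) ([]=⇒lookup j∈Y))

  ↑ʳ∈++⁻ : ∀ {X : Subset s} {Y : Subset t} {j} → (s ↑ʳ j) ∈ X ++ Y → j ∈ Y
  ↑ʳ∈++⁻ {X} {Y} {j} h = lookup⇒[]= j Y (trans (sym (lookup-++ʳ X Y j)) ([]=⇒lookup h))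

  ++-⊆⁻ : ∀ {X X′ : Subset s} {Y Y′ : Subset t} → X ++ Y ⊆ X′ ++ Y′ → X ⊆ X′ × Y ⊆ Y′
  ++-⊆⁻ h = (λ i∈ → ↑ˡ∈++⁻ (h (↑ˡ∈++⁺ i∈))) , (λ j∈ → ↑ʳ∈++⁻ (h (↑ʳ∈++⁺ j∈)))

  split : ∀ (W : Subset (s + t)) → take s W ++ drop s W ≡ W
  split = take++drop≡id s

  take-++ : ∀ (X : Subset s) (Y : Subset t) → take s (X ++ Y) ≡ X
  take-++ X Y = sym (++-injectiveˡ X (take s (X ++ Y)) (sym (split (X ++ Y))))

  drop-++ : ∀ (X : Subset s) (Y : Subset t) → drop s (X ++ Y) ≡ Y
  drop-++ X Y = sym (++-injectiveʳ X (take s (X ++ Y)) (sym (split (X ++ Y))))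

  take-∪ : ∀ (W V : Subset (s + t)) → take s (W ∪ V) ≡ take s W ∪ take s V
  take-∪ = take-zipWith _∨_

  drop-∪ : ∀ (W V : Subset (s + t)) → drop s (W ∪ V) ≡ drop s W ∪ drop s V
  drop-∪ = drop-zipWith _∨_

  take-∩ : ∀ (W V : Subset (s + t)) → take s (W ∩ V) ≡ take s W ∩ take s V
  take-∩ = take-zipWith _∧_

  drop-∩ : ∀ (W V : Subset (s + t)) → drop s (W ∩ V) ≡ drop s W ∩ drop s V
  drop-∩ = drop-zipWith _∧_

  split-⊆ : ∀ {W V : Subset (s + t)} → W ⊆ V → take s W ⊆ take s V × drop s W ⊆ drop s V
  split-⊆ {W} {V} W⊆V = ++-⊆⁻ (λ e∈ → subst (_ ∈_) (sym (split V)) (W⊆V (subst (_ ∈_) (split W) e∈)))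

  ∣split∣ : ∀ (W : Subset (s + t)) → ∣ W ∣ ≡ ∣ take s W ∣ + ∣ drop s W ∣
  ∣split∣ W = trans (cong ∣_∣ (sym (split W))) (∣p++q∣≡∣p∣+∣q∣ (take s W) (drop s W))

  ↑-cases : ∀ (e : Fin (s + t)) → (∃ λ i → i ↑ˡ t ≡ e) ⊎ (∃ λ j → s ↑ʳ j ≡ e)
  ↑-cases e with Fin.splitAt s e in eq
  ... | inj₁ i = inj₁ (i , splitAt⁻¹-↑ˡ eq)
  ... | inj₂ j = inj₂ (j , splitAt⁻¹-↑ʳ eq)

  ++-─-↑ˡ : ∀ (X : Subset s) (Y : Subset t) i → (X ++ Y) - (i ↑ˡ t) ≡ (X - i) ++ Y
  ++-─-↑ˡ X Y i = begin
    (X ++ Y) ─ ⁅ i ↑ˡ t ⁆       ≡⟨ cong ((X ++ Y) ─_) (⁅↑ˡ⁆ t i) ⟨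
    (X ++ Y) ─ (⁅ i ⁆ ++ ⊥)     ≡⟨ zipWith-++ _ X Y ⁅ i ⁆ ⊥ ⟩
    (X - i) ++ (Y ─ ⊥)          ≡⟨ cong ((X - i) ++_) (p─⊥≡p Y) ⟩
    (X - i) ++ Y                ∎
    where open ≡-Reasoning

  ++-─-↑ʳ : ∀ (X : Subset s) (Y : Subset t) j → (X ++ Y) - (s ↑ʳ j) ≡ X ++ (Y - j)
  ++-─-↑ʳ X Y j = begin
    (X ++ Y) ─ ⁅ s ↑ʳ j ⁆       ≡⟨ cong ((X ++ Y) ─_) (⁅↑ʳ⁆ s j) ⟨
    (X ++ Y) ─ (⊥ ++ ⁅ j ⁆)     ≡⟨ zipWith-++ _ X Y ⊥ ⁅ j ⁆ ⟩
    (X ─ ⊥) ++ (Y - j)          ≡⟨ cong (_++ (Y - j)) (p─⊥≡p X) ⟩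
    X ++ (Y - j)                ∎
    where open ≡-Reasoning

-- Adds two inequalities between sums, regrouped; this is how a sum of
-- submodular functions is seen to be submodular.
+-mono-≤-interchange : ∀ a b c d a′ b′ c′ d′ → a + b ≤ c + d → a′ + b′ ≤ c′ + d′ →
                       (a + a′) + (b + b′) ≤ (c + c′) + (d + d′)
+-mono-≤-interchange a b c d a′ b′ c′ d′ p q = begin
  (a + a′) + (b + b′)  ≡⟨ interchange a a′ b b′ ⟩
  (a + b) + (a′ + b′)  ≤⟨ +-mono-≤ p q ⟩
  (c + d) + (c′ + d′)  ≡⟨ interchange c d c′ d′ ⟩
  (c + c′) + (d + d′)  ∎
  where open ≤-Reasoning

+-cancel-≤-exchange : ∀ x y u v w z → x + y ≤ u + v → v + w ≤ x + z → w + y ≤ u + z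
+-cancel-≤-exchange x y u v w z p q = +-cancelʳ-≤ (x + v) _ _ (begin
  (w + y) + (x + v)  ≡⟨ rearrangeˡ x y v w ⟩
  (x + y) + (v + w)  ≤⟨ +-mono-≤ p q ⟩
  (u + v) + (x + z)  ≡⟨ rearrangeʳ u v x z ⟩
  (u + z) + (x + v)  ∎)
  where
  open ≤-Reasoning
  rearrangeˡ : ∀ x y v w → (w + y) + (x + v) ≡ (x + y) + (v + w)
  rearrangeˡ = solve-∀
  rearrangeʳ : ∀ u v x z → (u + v) + (x + z) ≡ (u + z) + (x + v)
  rearrangeʳ = solve-∀

+-bound : ∀ {x y u v p q p′ q′} → x ≤ u → y ≤ v → u + v ≤ p + q → p′ ≡ p → q′ ≡ q → x + y ≤ p′ + q′
+-bound x≤u y≤v u+v≤p+q refl refl = ≤-trans (+-mono-≤ x≤u y≤v) u+v≤p+q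

-- The pointwise minimum of two submodular functions f and g is submodular as
-- soon as f - g does not decrease from P and from Q to U = P ∪ Q
-- (V = P ∩ Q); stated for the eight values involved.
⊓-submodular : ∀ fU fV fP fQ gU gV gP gQ →
               fU + fV ≤ fP + fQ → gU + gV ≤ gP + gQ →
               fP + gU ≤ fU + gP → fQ + gU ≤ fU + gQ →
               (fU ⊓ gU) + (fV ⊓ gV) ≤ (fP ⊓ gP) + (fQ ⊓ gQ)
⊓-submodular fU fV fP fQ gU gV gP gQ f-sub g-sub P-cross Q-cross
  with ≤-total fP gP | ≤-total fQ gQ
... | inj₁ fP≤gP | inj₁ fQ≤gQ =
  +-bound (m⊓n≤m fU gU) (m⊓n≤m fV gV) f-sub (m≤n⇒m⊓n≡m fP≤gP) (m≤n⇒m⊓n≡m fQ≤gQ)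
... | inj₂ gP≤fP | inj₂ gQ≤fQ =
  +-bound (m⊓n≤n fU gU) (m⊓n≤n fV gV) g-sub (m≥n⇒m⊓n≡n gP≤fP) (m≥n⇒m⊓n≡n gQ≤fQ)
... | inj₁ fP≤gP | inj₂ gQ≤fQ =
  +-bound (m⊓n≤n fU gU) (m⊓n≤m fV gV) (+-cancel-≤-exchange fU fV fP fQ gU gQ f-sub Q-cross)
        (m≤n⇒m⊓n≡m fP≤gP) (m≥n⇒m⊓n≡n gQ≤fQ)
... | inj₂ gP≤fP | inj₁ fQ≤gQ =
  +-bound (m⊓n≤n fU gU) (m⊓n≤m fV gV)
        (≤-trans (+-cancel-≤-exchange fU fV fQ fP gU gP
                   (≤-trans f-sub (≤-reflexive (+-comm fP fQ))) P-cross)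
                 (≤-reflexive (+-comm fQ gP)))
        (m≥n⇒m⊓n≡n gP≤fP) (m≤n⇒m⊓n≡m fQ≤gQ)

+-tight : ∀ {a a′ b b′} → a ≤ a′ → b ≤ b′ → a′ + b′ ≤ a + b → a ≡ a′ × b ≡ b′
+-tight {a} {a′} {b} {b′} a≤a′ b≤b′ a′+b′≤a+b =
  ≤-antisym a≤a′ (+-cancelʳ-≤ b′ a′ a (≤-trans a′+b′≤a+b (+-monoʳ-≤ a b≤b′))) ,
  ≤-antisym b≤b′ (+-cancelˡ-≤ a′ b′ b (≤-trans a′+b′≤a+b (+-monoˡ-≤ b a≤a′)))

⊓-preserved⇒≤ʳ : ∀ {a b a′ b′} → a′ ⊓ b′ ≡ a ⊓ b → b < a → b ≤ b′
⊓-preserved⇒≤ʳ {a} {b} {a′} {b′} same b<a = begin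
  b        ≡⟨ m≥n⇒m⊓n≡n (<⇒≤ b<a) ⟨
  a ⊓ b    ≡⟨ same ⟨
  a′ ⊓ b′  ≤⟨ m⊓n≤n a′ b′ ⟩
  b′       ∎
  where open ≤-Reasoning

⊓-preserved⇒≤ˡ : ∀ {a b a′ b′} → a′ ⊓ b′ ≡ a ⊓ b → a ≤ b → a ≤ a′
⊓-preserved⇒≤ˡ {a} {b} {a′} {b′} same a≤b = begin
  a        ≡⟨ m≤n⇒m⊓n≡m a≤b ⟨
  a ⊓ b    ≡⟨ same ⟨
  a′ ⊓ b′  ≤⟨ m⊓n≤m a′ b′ ⟩
  a′       ∎
  where open ≤-Reasoning

⊓-preserved : ∀ {a b a′ b′} → b < a → a ≤ suc a′ → b′ ≡ b → a′ ⊓ b′ ≡ a ⊓ b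
⊓-preserved b<a a≤1+a′ refl =
  trans (m≥n⇒m⊓n≡n (≤-pred (≤-trans b<a a≤1+a′))) (sym (m≥n⇒m⊓n≡n (<⇒≤ b<a)))

module MatroidTheory {n : ℕ} (M : Matroid n) where

  r : Subset n → ℕ
  r = rank M

  r-mono : ∀ {p q} → p ⊆ q → r p ≤ r q
  r-mono {p} {q} = rank-mono M p q

  r-submodular : ∀ P Q {U V} → U ⊆ P ∪ Q → V ⊆ P ∩ Q → r U + r V ≤ r P + r Q
  r-submodular P Q U⊆ V⊆ = ≤-trans (+-mono-≤ (r-mono U⊆) (r-mono V⊆)) (rank-sub M P Q)

  r-subadditive : ∀ P Q {Z} → Z ⊆ P ∪ Q → r Z ≤ r P + r Q
  r-subadditive P Q Z⊆ = ≤-trans (m≤m+n _ (r ⊥)) (r-submodular P Q Z⊆ ⊥⊆)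

  r≤r+∣─∣ : ∀ Z U → r Z ≤ r U + ∣ Z ─ U ∣
  r≤r+∣─∣ Z U =
    ≤-trans (r-subadditive U (Z ─ U) (p⊆q∪[p─q] Z U)) (+-monoʳ-≤ (r U) (rank-≤ M (Z ─ U)))

  r≤1+r[p-x] : ∀ Z e → r Z ≤ suc (r (Z - e))
  r≤1+r[p-x] Z e = begin
    r Z                  ≤⟨ r-subadditive (Z - e) ⁅ e ⁆ (p⊆[p-x]∪⁅x⁆ Z e) ⟩
    r (Z - e) + r ⁅ e ⁆  ≤⟨ +-monoʳ-≤ (r (Z - e)) (≤-trans (rank-≤ M ⁅ e ⁆) (≤-reflexive (∣⁅x⁆∣≡1 e))) ⟩
    r (Z - e) + 1        ≡⟨ +-comm _ 1 ⟩
    suc (r (Z - e))      ∎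
    where open ≤-Reasoning

  r-increment-∪ : ∀ {X X′} A → X ⊆ X′ → r X + r (X′ ∪ A) ≤ r X′ + r (X ∪ A)
  r-increment-∪ {X} {X′} A X⊆X′ = begin
    r X + r (X′ ∪ A)  ≡⟨ +-comm (r X) _ ⟩
    r (X′ ∪ A) + r X  ≤⟨ r-submodular X′ (X ∪ A) (∪-mono ⊆-refl (q⊆p∪q X A))
                                                   (∩-glb X⊆X′ (p⊆p∪q A)) ⟩
    r X′ + r (X ∪ A)  ∎
    where open ≤-Reasoning

  independent? : ∀ D → Dec (Independent M D)
  independent? D = r D ≟ ∣ D ∣

  dependent⇒r< : ∀ {D} → ¬ Independent M D → r D < ∣ D ∣
  dependent⇒r< {D} = ≤∧≢⇒< (rank-≤ M D)

  independent-⊆ : ∀ {I J} → Independent M I → J ⊆ I → Independent M J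
  independent-⊆ {I} {J} indI J⊆I = ≤-antisym (rank-≤ M J) (+-cancelʳ-≤ ∣ I ─ J ∣ _ _ (begin
    ∣ J ∣ + ∣ I ─ J ∣  ≡⟨ ∣q∣+∣p─q∣≡∣p∣ J⊆I ⟩
    ∣ I ∣              ≡⟨ indI ⟨
    r I                ≤⟨ r≤r+∣─∣ I J ⟩
    r J + ∣ I ─ J ∣    ∎))
    where open ≤-Reasoning

  independent-⊥ : Independent M ⊥
  independent-⊥ = ≤-antisym (rank-≤ M ⊥) (≤-trans (≤-reflexive (∣⊥∣≡0 n)) z≤n)

  r-∪-spanned : ∀ J K → (∀ y → y ∈ K → r (J ∪ ⁅ y ⁆) ≤ r J) → r (J ∪ K) ≤ r J
  r-∪-spanned J K = go ∣ K ∣ K ≤-refl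
    where
    open ≤-Reasoning
    go : ∀ f K → ∣ K ∣ ≤ f → (∀ y → y ∈ K → r (J ∪ ⁅ y ⁆) ≤ r J) → r (J ∪ K) ≤ r J
    go f K ∣K∣≤f spanned with nonempty? K
    ... | no K-empty = r-mono (∪-lub ⊆-refl (λ y∈K → contradiction (_ , y∈K) K-empty))
    go zero    K ∣K∣≤0 spanned | yes (x , x∈K) = contradiction x∈K (∣p∣≡0⇒x∉p (n≤0⇒n≡0 ∣K∣≤0))
    go (suc f) K ∣K∣≤f spanned | yes (x , x∈K) = +-cancelʳ-≤ (r J) _ _ (begin
      r (J ∪ K) + r J                  ≤⟨ r-submodular (J ∪ (K - x)) (J ∪ ⁅ x ⁆) cover
                                            (∩-glb (p⊆p∪q (K - x)) (p⊆p∪q ⁅ x ⁆)) ⟩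
      r (J ∪ (K - x)) + r (J ∪ ⁅ x ⁆)  ≤⟨ +-mono-≤ rest (spanned x x∈K) ⟩
      r J + r J                        ∎)
      where
      cover : J ∪ K ⊆ (J ∪ (K - x)) ∪ (J ∪ ⁅ x ⁆)
      cover = ∪-lub (λ y∈ → p⊆p∪q (J ∪ ⁅ x ⁆) (p⊆p∪q (K - x) y∈))
                    (⊆-trans (p⊆[p-x]∪⁅x⁆ K x) (∪-mono (q⊆p∪q J (K - x)) (q⊆p∪q J ⁅ x ⁆)))
      rest : r (J ∪ (K - x)) ≤ r J
      rest = go f (K - x) (≤-pred (≤-trans (≤-reflexive (1+∣p-x∣≡∣p∣ x∈K)) ∣K∣≤f))
                (λ y y∈ → spanned y (p─q⊆p K ⁅ x ⁆ y∈))

  IsBasis : Subset n → Subset n → Set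
  IsBasis Y J = J ⊆ Y × Independent M J × r J ≡ r Y

  -- Every independent subset of Y extends to a basis of Y: add elements of Y
  -- while independence is kept (the fuel f bounds the number of additions);
  -- once no element can be added, the closure lemma gives full rank.
  extend-to-basis : ∀ {I Y} → Independent M I → I ⊆ Y → ∃ λ J → I ⊆ J × IsBasis Y J
  extend-to-basis {I} {Y} = go n I (m≤m+n n ∣ I ∣)
    where
    Augmenting : Subset n → Fin n → Set
    Augmenting I y = y ∈ Y × y ∉ I × Independent M (I ∪ ⁅ y ⁆)

    augmenting? : ∀ I y → Dec (Augmenting I y)
    augmenting? I y = (y ∈? Y) ×-dec ¬? (y ∈? I) ×-dec independent? (I ∪ ⁅ y ⁆)

    go : ∀ f I → n ≤ f + ∣ I ∣ → Independent M I → I ⊆ Y → ∃ λ J → I ⊆ J × IsBasis Y J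
    go f I n≤f+∣I∣ indI I⊆Y with any? (augmenting? I)
    go zero I n≤∣I∣ indI I⊆Y | yes (y , _ , y∉I , _) =
      contradiction (subst (y ∈_) (sym (∣p∣≡n⇒p≡⊤ (≤-antisym (∣p∣≤n I) n≤∣I∣))) ∈⊤) y∉I
    go (suc f) I n≤f+∣I∣ indI I⊆Y | yes (y , y∈Y , y∉I , indI+y)
      with go f (I ∪ ⁅ y ⁆) n≤f+∣I+y∣ indI+y (∪-lub I⊆Y (x∈p⇒⁅x⁆⊆p y∈Y))
      where
      n≤f+∣I+y∣ : n ≤ f + ∣ I ∪ ⁅ y ⁆ ∣
      n≤f+∣I+y∣ = ≤-trans n≤f+∣I∣ (≤-reflexive (trans (sym (+-suc f _))
                                                    (cong (f +_) (sym (∣p∪⁅x⁆∣≡1+∣p∣ y∉I)))))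
    ... | J , I+y⊆J , basisJ = J , (λ x∈ → I+y⊆J (p⊆p∪q ⁅ y ⁆ x∈)) , basisJ
    go f I _ indI I⊆Y | no no-augmentation =
      I , ⊆-refl , I⊆Y , indI , ≤-antisym (r-mono I⊆Y) rY≤rI
      where
      spanned : ∀ y → y ∈ Y → r (I ∪ ⁅ y ⁆) ≤ r I
      spanned y y∈Y with y ∈? I | independent? (I ∪ ⁅ y ⁆)
      ... | yes y∈I | _ = r-mono (∪-lub ⊆-refl (x∈p⇒⁅x⁆⊆p y∈I))
      ... | no y∉I | yes indI+y = contradiction (y , y∈Y , y∉I , indI+y) no-augmentation
      ... | no y∉I | no depI+y = ≤-pred (begin
        suc (r (I ∪ ⁅ y ⁆))  ≤⟨ dependent⇒r< depI+y ⟩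
        ∣ I ∪ ⁅ y ⁆ ∣        ≡⟨ ∣p∪⁅x⁆∣≡1+∣p∣ y∉I ⟩
        suc ∣ I ∣            ≡⟨ cong suc indI ⟨
        suc (r I)            ∎)
        where open ≤-Reasoning
      rY≤rI : r Y ≤ r I
      rY≤rI = ≤-trans (r-mono (q⊆p∪q I Y)) (r-∪-spanned I Y spanned)

  basis-of : ∀ Y → ∃ (IsBasis Y)
  basis-of Y with extend-to-basis independent-⊥ (⊥⊆ {p = Y})
  ... | J , _ , basisJ = J , basisJ

  Circuit : Subset n → Set
  Circuit = IsCircuit (Independent M)

  -- If D is dependent but D - e is independent, some circuit C ⊆ D contains e:
  -- delete elements other than e while D stays dependent; what remains is a
  -- minimal dependent set.
  circuit-through : ∀ {D e} → e ∈ D → ¬ Independent M D → Independent M (D - e) →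
                    ∃ λ C → Circuit C × e ∈ C × C ⊆ D
  circuit-through {D} {e} = go ∣ D ∣ D ≤-refl
    where
    Shrinkable : Subset n → Fin n → Set
    Shrinkable D x = x ∈ D × x ≢ e × ¬ Independent M (D - x)

    shrinkable? : ∀ D x → Dec (Shrinkable D x)
    shrinkable? D x = (x ∈? D) ×-dec ¬? (x Fin.≟ e) ×-dec ¬? (independent? (D - x))

    go : ∀ f D → ∣ D ∣ ≤ f → e ∈ D → ¬ Independent M D → Independent M (D - e) →
         ∃ λ C → Circuit C × e ∈ C × C ⊆ D
    go f D ∣D∣≤f e∈D depD indD-e with any? (shrinkable? D)
    go zero D ∣D∣≤0 e∈D _ _ | yes _ = contradiction e∈D (∣p∣≡0⇒x∉p (n≤0⇒n≡0 ∣D∣≤0))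
    go (suc f) D ∣D∣≤f e∈D depD indD-e | yes (x , x∈D , x≢e , depD-x)
      with go f (D - x) (≤-pred (≤-trans (≤-reflexive (1+∣p-x∣≡∣p∣ x∈D)) ∣D∣≤f))
              (x∈p∧x≢y⇒x∈p-y e∈D (x≢e ∘ sym)) depD-x (independent-⊆ indD-e D-x-e⊆D-e)
      where
      D-x-e⊆D-e : (D - x) - e ⊆ D - e
      D-x-e⊆D-e = ─-monoˡ ⁅ e ⁆ (p─q⊆p D ⁅ x ⁆)
    ... | C , circuitC , e∈C , C⊆D-x = C , circuitC , e∈C , ⊆-trans C⊆D-x (p─q⊆p D ⁅ x ⁆)
    go f D _ e∈D depD indD-e | no none-shrinkable = D , (depD , minimal) , e∈D , ⊆-refl
      where
      minimal : ∀ D′ → D′ ⊂ D → Independent M D′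
      minimal D′ (D′⊆D , x , x∈D , x∉D′) = independent-⊆ indD-x D′⊆D-x
        where
        D′⊆D-x : D′ ⊆ D - x
        D′⊆D-x y∈ = x∈p∧x≢y⇒x∈p-y (D′⊆D y∈) (λ { refl → x∉D′ y∈ })
        indD-x : Independent M (D - x)
        indD-x with x Fin.≟ e | independent? (D - x)
        ... | yes refl | _        = indD-e
        ... | no  _    | yes ind  = ind
        ... | no  x≢e  | no  dep  = contradiction (x , x∈D , x≢e , dep) none-shrinkable

  RankStableUnderDeletion : Subset n → Set
  RankStableUnderDeletion Z = ∀ e → e ∈ Z → r (Z - e) ≡ r Z

  -- Cyclic sets are rank-stable: if e lies in a circuit C ⊆ Z, then
  -- r Z + r (C - e) ≤ r (Z - e) + r C ≤ r (Z - e) + r (C - e).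
  cyclic⇒stable : ∀ {Z} → CyclicIn M Z → RankStableUnderDeletion Z
  cyclic⇒stable {Z} cyclicZ e e∈Z with cyclicZ e e∈Z
  ... | C , (depC , minimalC) , e∈C , C⊆Z =
    ≤-antisym (r-mono (p─q⊆p Z ⁅ e ⁆)) (+-cancelʳ-≤ (r (C - e)) _ _ (begin
      r Z + r (C - e)        ≤⟨ r-submodular (Z - e) C cover
                                  (∩-glb (─-monoˡ ⁅ e ⁆ C⊆Z) (p─q⊆p C ⁅ e ⁆)) ⟩
      r (Z - e) + r C        ≤⟨ +-monoʳ-≤ (r (Z - e)) rC≤rC-e ⟩
      r (Z - e) + r (C - e)  ∎))
    where
    open ≤-Reasoning
    cover : Z ⊆ (Z - e) ∪ C
    cover = ⊆-trans (p⊆[p-x]∪⁅x⁆ Z e) (∪-mono ⊆-refl (x∈p⇒⁅x⁆⊆p e∈C))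
    rC≤rC-e : r C ≤ r (C - e)
    rC≤rC-e = ≤-pred (begin
      suc (r C)      ≤⟨ dependent⇒r< depC ⟩
      ∣ C ∣          ≡⟨ 1+∣p-x∣≡∣p∣ e∈C ⟨
      suc ∣ C - e ∣  ≡⟨ cong suc (minimalC (C - e) (x∈p⇒p-x⊂p e∈C)) ⟨
      suc (r (C - e)) ∎)

  -- Conversely, if r (Z - e) = r Z then a basis J of Z - e stays dependent when e
  -- is added, and the circuit through e inside J ∪ ⁅ e ⁆ lies in Z.
  stable⇒cyclic : ∀ {Z} → RankStableUnderDeletion Z → CyclicIn M Z
  stable⇒cyclic {Z} stable e e∈Z with basis-of (Z - e)
  ... | J , J⊆Z-e , indJ , rJ≡rZ-e =
    let C , circuitC , e∈C , C⊆J+e = circuit-through e∈J+e depJ+e (independent-⊆ indJ J+e-e⊆J)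
    in  C , circuitC , e∈C , ⊆-trans C⊆J+e J+e⊆Z
    where
    e∈J+e : e ∈ J ∪ ⁅ e ⁆
    e∈J+e = q⊆p∪q J ⁅ e ⁆ (x∈⁅x⁆ e)
    J+e⊆Z : J ∪ ⁅ e ⁆ ⊆ Z
    J+e⊆Z = ∪-lub (λ x∈ → p─q⊆p Z ⁅ e ⁆ (J⊆Z-e x∈)) (x∈p⇒⁅x⁆⊆p e∈Z)
    e∉J : e ∉ J
    e∉J e∈J = x∈p-y⇒x≢y Z (J⊆Z-e e∈J) refl
    depJ+e : ¬ Independent M (J ∪ ⁅ e ⁆)
    depJ+e indJ+e = 1+n≰n (begin
      suc ∣ J ∣        ≡⟨ ∣p∪⁅x⁆∣≡1+∣p∣ e∉J ⟨
      ∣ J ∪ ⁅ e ⁆ ∣    ≡⟨ indJ+e ⟨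
      r (J ∪ ⁅ e ⁆)    ≤⟨ r-mono J+e⊆Z ⟩
      r Z              ≡⟨ stable e e∈Z ⟨
      r (Z - e)        ≡⟨ rJ≡rZ-e ⟨
      r J              ≡⟨ indJ ⟩
      ∣ J ∣            ∎)
      where open ≤-Reasoning
    J+e-e⊆J : (J ∪ ⁅ e ⁆) - e ⊆ J
    J+e-e⊆J {x} x∈ with x∈p∪q⁻ J ⁅ e ⁆ (p─q⊆p (J ∪ ⁅ e ⁆) ⁅ e ⁆ x∈)
    ... | inj₁ x∈J = x∈J
    ... | inj₂ x∈⁅e⁆ = contradiction (x∈⁅y⁆⇒x≡y e x∈⁅e⁆) (x∈p-y⇒x≢y (J ∪ ⁅ e ⁆) x∈)

  basis⇒basis-of-restriction : ∀ {Z J} → IsBasis Z J → IsBasisOfRestriction M Z J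
  basis⇒basis-of-restriction {Z} {J} (J⊆Z , indJ , rJ≡rZ) = J⊆Z , indJ , maximal
    where
    maximal : ∀ J′ → J ⊆ J′ → J′ ⊆ Z → Independent M J′ → J′ ≡ J
    maximal J′ J⊆J′ J′⊆Z indJ′ = sym (⊆∧∣∣≥⇒≡ J⊆J′ (begin
      ∣ J′ ∣  ≡⟨ indJ′ ⟨
      r J′    ≤⟨ r-mono J′⊆Z ⟩
      r Z     ≡⟨ rJ≡rZ ⟨
      r J     ≡⟨ indJ ⟩
      ∣ J ∣   ∎))
      where open ≤-Reasoning

  coloop⇒rank-drop : ∀ {Z e} → IsColoopOfRestriction M Z e → r (Z - e) ≢ r Z
  coloop⇒rank-drop {Z} {e} (_ , in-every-basis) rZ-e≡rZ with basis-of (Z - e)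
  ... | J , J⊆Z-e , indJ , rJ≡rZ-e = x∈p-y⇒x≢y Z (J⊆Z-e e∈J) refl
    where
    e∈J : e ∈ J
    e∈J = in-every-basis J (basis⇒basis-of-restriction
            (⊆-trans J⊆Z-e (p─q⊆p Z ⁅ e ⁆) , indJ , trans rJ≡rZ-e rZ-e≡rZ))

  rank-drop⇒coloop : ∀ {Z e} → e ∈ Z → r (Z - e) ≢ r Z → IsColoopOfRestriction M Z e
  rank-drop⇒coloop {Z} {e} e∈Z rank-drops = e∈Z , in-every-basis
    where
    in-every-basis : ∀ Bs → IsBasisOfRestriction M Z Bs → e ∈ Bs
    in-every-basis Bs (Bs⊆Z , indBs , maximal) with e ∈? Bs
    ... | yes e∈Bs = e∈Bs
    ... | no  e∉Bs with extend-to-basis indBs Bs⊆Z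
    ... | J , Bs⊆J , J⊆Z , indJ , rJ≡rZ = contradiction rZ-e≡rZ rank-drops
      where
      rZ-e≡rZ : r (Z - e) ≡ r Z
      rZ-e≡rZ = ≤-antisym (r-mono (p─q⊆p Z ⁅ e ⁆)) (begin
        r Z   ≡⟨ rJ≡rZ ⟨
        r J   ≡⟨ cong r (maximal J Bs⊆J J⊆Z indJ) ⟩
        r Bs  ≤⟨ r-mono (λ x∈ → x∈p∧x≢y⇒x∈p-y (Bs⊆Z x∈) (λ { refl → e∉Bs x∈ })) ⟩
        r (Z - e) ∎)
        where open ≤-Reasoning

  coloops-in⇔ : ∀ X A → (∀ e → IsColoopOfRestriction M (X ∪ A) e → e ∈ A) ⇔
                        (∀ i → i ∈ X → r ((X - i) ∪ A) ≡ r (X ∪ A))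
  coloops-in⇔ X A = mk⇔ to from
    where
    shrink : ∀ i → (X - i) ∪ A ⊆ X ∪ A
    shrink i = ∪-mono (p─q⊆p X ⁅ i ⁆) ⊆-refl

    to : (∀ e → IsColoopOfRestriction M (X ∪ A) e → e ∈ A) → ∀ i → i ∈ X → r ((X - i) ∪ A) ≡ r (X ∪ A)
    to coloops-in-A i i∈X with i ∈? A
    ... | yes i∈A = ≤-antisym (r-mono (shrink i)) (r-mono X∪A⊆[X-i]∪A)
      where
      X∪A⊆[X-i]∪A : X ∪ A ⊆ (X - i) ∪ A
      X∪A⊆[X-i]∪A {x} x∈ with x Fin.≟ i | x∈p∪q⁻ X A x∈
      ... | yes refl | _        = q⊆p∪q (X - i) A i∈A
      ... | no  x≢i  | inj₁ x∈X = p⊆p∪q A (x∈p∧x≢y⇒x∈p-y x∈X x≢i)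
      ... | no  _    | inj₂ x∈A = q⊆p∪q (X - i) A x∈A
    ... | no  i∉A = ≤-antisym (r-mono (shrink i)) (begin
      r (X ∪ A)          ≡⟨ rank-kept ⟨
      r ((X ∪ A) - i)    ≤⟨ r-mono [X∪A]-i⊆[X-i]∪A ⟩
      r ((X - i) ∪ A)    ∎)
      where
      open ≤-Reasoning
      rank-kept : r ((X ∪ A) - i) ≡ r (X ∪ A)
      rank-kept with r ((X ∪ A) - i) ≟ r (X ∪ A)
      ... | yes kept  = kept
      ... | no  drops = contradiction (coloops-in-A i (rank-drop⇒coloop (p⊆p∪q A i∈X) drops)) i∉A
      [X∪A]-i⊆[X-i]∪A : (X ∪ A) - i ⊆ (X - i) ∪ A
      [X∪A]-i⊆[X-i]∪A x∈ with x∈p∪q⁻ X A (p─q⊆p (X ∪ A) ⁅ i ⁆ x∈)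
      ... | inj₁ x∈X = p⊆p∪q A (x∈p∧x≢y⇒x∈p-y x∈X (x∈p-y⇒x≢y (X ∪ A) x∈))
      ... | inj₂ x∈A = q⊆p∪q (X - i) A x∈A

    from : (∀ i → i ∈ X → r ((X - i) ∪ A) ≡ r (X ∪ A)) → ∀ e → IsColoopOfRestriction M (X ∪ A) e → e ∈ A
    from kept e coloop with e ∈? A | x∈p∪q⁻ X A (proj₁ coloop)
    ... | yes e∈A | _        = e∈A
    ... | no  _   | inj₂ e∈A = e∈A
    ... | no  e∉A | inj₁ e∈X = contradiction rank-kept (coloop⇒rank-drop coloop)
      where
      [X-e]∪A⊆[X∪A]-e : (X - e) ∪ A ⊆ (X ∪ A) - e
      [X-e]∪A⊆[X∪A]-e = ∪-lub (─-monoˡ ⁅ e ⁆ (p⊆p∪q A))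
                              (λ x∈A → x∈p∧x≢y⇒x∈p-y (q⊆p∪q X A x∈A) (λ { refl → e∉A x∈A }))
      rank-kept : r ((X ∪ A) - e) ≡ r (X ∪ A)
      rank-kept = ≤-antisym (r-mono (p─q⊆p (X ∪ A) ⁅ e ⁆))
                            (≤-trans (≤-reflexive (sym (kept e e∈X))) (r-mono [X-e]∪A⊆[X∪A]-e))

Cyclic-cong : ∀ {n} {I₁ I₂ : Subset n → Set} → (∀ W → I₁ W ⇔ I₂ W) → ∀ Z → Cyclic I₁ Z ⇔ Cyclic I₂ Z
Cyclic-cong I₁⇔I₂ Z = mk⇔ (transport I₁⇔I₂) (transport (λ W → ⇔-sym (I₁⇔I₂ W)))
  where
  transport : ∀ {J₁ J₂ : Subset _ → Set} → (∀ W → J₁ W ⇔ J₂ W) → Cyclic J₁ Z → Cyclic J₂ Z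
  transport J₁⇔J₂ cyclic e e∈Z with cyclic e e∈Z
  ... | C , (depC , minimalC) , e∈C , C⊆Z =
    C , (depC ∘ Equivalence.from (J₁⇔J₂ C) , λ D D⊂C → Equivalence.to (J₁⇔J₂ D) (minimalC D D⊂C)) ,
    e∈C , C⊆Z

-- freeing N B is N with every element of B made a coloop, i.e. (N \ B) ⊕ free(B):
-- its rank is rank N (Y ─ B) + ∣ Y ∩ B ∣.
freeing : ∀ {t} → Matroid t → Subset t → Matroid t
freeing {t} N B = record
  { rank      = rankᶠ
  ; rank-≤    = rankᶠ-≤
  ; rank-mono = λ Y Y′ Y⊆Y′ → +-mono-≤ (N.r-mono (─-monoˡ B Y⊆Y′)) (p⊆q⇒∣p∣≤∣q∣ (∩-mono Y⊆Y′ ⊆-refl))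
  ; rank-sub  = rankᶠ-sub
  }
  where
  module N = MatroidTheory N

  rankᶠ : Subset t → ℕ
  rankᶠ Y = rank N (Y ─ B) + ∣ Y ∩ B ∣

  rankᶠ-≤ : ∀ Y → rankᶠ Y ≤ ∣ Y ∣
  rankᶠ-≤ Y = begin
    rank N (Y ─ B) + ∣ Y ∩ B ∣  ≤⟨ +-monoˡ-≤ ∣ Y ∩ B ∣ (rank-≤ N (Y ─ B)) ⟩
    ∣ Y ─ B ∣ + ∣ Y ∩ B ∣       ≡⟨ +-comm ∣ Y ─ B ∣ _ ⟩
    ∣ Y ∩ B ∣ + ∣ Y ─ B ∣       ≡⟨ ∣p∩q∣+∣p─q∣≡∣p∣ Y B ⟩
    ∣ Y ∣                       ∎
    where open ≤-Reasoning

  -- Submodular as the sum of the rank of N on Y ─ B and the modular ∣ Y ∩ B ∣.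
  rankᶠ-sub : ∀ Y Y′ → rankᶠ (Y ∪ Y′) + rankᶠ (Y ∩ Y′) ≤ rankᶠ Y + rankᶠ Y′
  rankᶠ-sub Y Y′ =
    +-mono-≤-interchange
      (rank N ((Y ∪ Y′) ─ B)) (rank N ((Y ∩ Y′) ─ B)) (rank N (Y ─ B)) (rank N (Y′ ─ B))
      (∣ (Y ∪ Y′) ∩ B ∣) (∣ (Y ∩ Y′) ∩ B ∣) (∣ Y ∩ B ∣) (∣ Y′ ∩ B ∣)
      (N.r-submodular (Y ─ B) (Y′ ─ B) ([p∪q]─r⊆[p─r]∪[q─r] Y Y′ B)
                      (∩-glb (─-monoˡ B (p∩q⊆p Y Y′)) (─-monoˡ B (p∩q⊆q Y Y′))))
      (≤-trans (+-mono-≤ (p⊆q⇒∣p∣≤∣q∣ (⊆-reflexive (∩-distribʳ-∪ B Y Y′)))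
                         (p⊆q⇒∣p∣≤∣q∣ (∩-glb (∩-mono (p∩q⊆p Y Y′) ⊆-refl) (∩-mono (p∩q⊆q Y Y′) ⊆-refl))))
               (≤-reflexive (∣p∪q∣+∣p∩q∣≡∣p∣+∣q∣ (Y ∩ B) (Y′ ∩ B))))

module Freeing {t : ℕ} (N : Matroid t) (B : Subset t) where

  private module N = MatroidTheory N

  rank-freeing-disjoint : ∀ {Y} → Empty (Y ∩ B) → rank (freeing N B) Y ≡ rank N Y
  rank-freeing-disjoint {Y} disjoint = begin
    rank N (Y ─ B) + ∣ Y ∩ B ∣  ≡⟨ cong₂ _+_ (cong (rank N) Y─B≡Y) (cong ∣_∣ (Empty-unique disjoint)) ⟩
    rank N Y + ∣ ⊥ {t} ∣        ≡⟨ cong (rank N Y +_) (∣⊥∣≡0 t) ⟩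
    rank N Y + 0                ≡⟨ +-identityʳ _ ⟩
    rank N Y                    ∎
    where
    open ≡-Reasoning
    Y─B≡Y : Y ─ B ≡ Y
    Y─B≡Y = ⊆-antisym (p─q⊆p Y B)
      (λ x∈Y → x∈p∧x∉q⇒x∈p─q x∈Y (λ x∈B → disjoint (_ , x∈p∩q⁺ (x∈Y , x∈B))))

  freeing-independent⇔ : ∀ {Y} → Independent (freeing N B) Y ⇔ Independent N (Y ─ B)
  freeing-independent⇔ {Y} = mk⇔
    (λ indᶠ → +-cancelʳ-≡ ∣ Y ∩ B ∣ _ _ (trans indᶠ (sym ∣Y─B∣+∣Y∩B∣≡∣Y∣)))
    (λ ind → trans (cong (_+ ∣ Y ∩ B ∣) ind) ∣Y─B∣+∣Y∩B∣≡∣Y∣)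
    where
    ∣Y─B∣+∣Y∩B∣≡∣Y∣ : ∣ Y ─ B ∣ + ∣ Y ∩ B ∣ ≡ ∣ Y ∣
    ∣Y─B∣+∣Y∩B∣≡∣Y∣ = trans (+-comm ∣ Y ─ B ∣ _) (∣p∩q∣+∣p─q∣≡∣p∣ Y B)

  rank-freeing-drop : ∀ {Y j} → j ∈ Y → j ∈ B → rank (freeing N B) (Y - j) < rank (freeing N B) Y
  rank-freeing-drop {Y} {j} j∈Y j∈B =
    +-mono-≤-< (N.r-mono (─-monoˡ B (p─q⊆p Y ⁅ j ⁆))) (p⊂q⇒∣p∣<∣q∣ [Y-j]∩B⊂Y∩B)
    where
    [Y-j]∩B⊂Y∩B : (Y - j) ∩ B ⊂ Y ∩ B
    [Y-j]∩B⊂Y∩B = ∩-mono (p─q⊆p Y ⁅ j ⁆) ⊆-refl , j , x∈p∩q⁺ (j∈Y , j∈B) ,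
                  λ j∈ → x∈p-y⇒x≢y Y (p∩q⊆p (Y - j) B j∈) refl

  -- Enlarging Y to Y′ raises rank N by at most as much as the freed rank: the
  -- rank of Y′ exceeds that of U = Y ∪ (Y′ ─ B) by at most the number of new
  -- elements of B, and submodularity compares U with Y and Y′ ─ B.
  rank-freeing-increment : ∀ {Y Y′} → Y ⊆ Y′ →
                           rank (freeing N B) Y + rank N Y′ ≤ rank (freeing N B) Y′ + rank N Y
  rank-freeing-increment {Y} {Y′} Y⊆Y′ = begin
    (rank N (Y ─ B) + ∣ Y ∩ B ∣) + rank N Y′
      ≤⟨ +-monoʳ-≤ (rank N (Y ─ B) + ∣ Y ∩ B ∣) rY′≤rU+∣D∣ ⟩
    (rank N (Y ─ B) + ∣ Y ∩ B ∣) + (rank N U + ∣ D ∣)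
      ≡⟨ rearrange (rank N (Y ─ B)) (∣ Y ∩ B ∣) (rank N U) (∣ D ∣) ⟩
    (rank N U + rank N (Y ─ B)) + (∣ Y ∩ B ∣ + ∣ D ∣)
      ≤⟨ +-mono-≤ rU-submodular (≤-reflexive (∣q∣+∣p─q∣≡∣p∣ (∩-mono Y⊆Y′ ⊆-refl))) ⟩
    (rank N Y + rank N (Y′ ─ B)) + ∣ Y′ ∩ B ∣
      ≡⟨ rearrange′ (rank N Y) (rank N (Y′ ─ B)) (∣ Y′ ∩ B ∣) ⟩
    (rank N (Y′ ─ B) + ∣ Y′ ∩ B ∣) + rank N Y
      ∎
    where
    open ≤-Reasoning
    U D : Subset t
    U = Y ∪ (Y′ ─ B)
    D = (Y′ ∩ B) ─ (Y ∩ B)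
    rU-submodular : rank N U + rank N (Y ─ B) ≤ rank N Y + rank N (Y′ ─ B)
    rU-submodular = N.r-submodular Y (Y′ ─ B) ⊆-refl (∩-glb (p─q⊆p Y B) (─-monoˡ B Y⊆Y′))
    Y′─U⊆D : Y′ ─ U ⊆ D
    Y′─U⊆D {x} x∈ with x ∈? B
    ... | yes x∈B = x∈p∧x∉q⇒x∈p─q (x∈p∩q⁺ (p─q⊆p Y′ U x∈ , x∈B))
                      (λ x∈Y∩B → x∈p─q⇒x∉q Y′ U x∈ (p⊆p∪q (Y′ ─ B) (p∩q⊆p Y B x∈Y∩B)))
    ... | no  x∉B = contradiction (q⊆p∪q Y (Y′ ─ B) (x∈p∧x∉q⇒x∈p─q (p─q⊆p Y′ U x∈) x∉B))
                                  (x∈p─q⇒x∉q Y′ U x∈)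
    rY′≤rU+∣D∣ : rank N Y′ ≤ rank N U + ∣ D ∣
    rY′≤rU+∣D∣ = ≤-trans (N.r≤r+∣─∣ Y′ U) (+-monoʳ-≤ (rank N U) (p⊆q⇒∣p∣≤∣q∣ Y′─U⊆D))
    rearrange : ∀ a b c d → (a + b) + (c + d) ≡ (c + a) + (b + d)
    rearrange = solve-∀
    rearrange′ : ∀ a b c → (a + b) + c ≡ (b + c) + a
    rearrange′ = solve-∀

module PrincipalSum {s t : ℕ} (M : Matroid s) (N : Matroid t) (A : Subset s) (B : Subset t) where

  private
    module M = MatroidTheory M
    module N = MatroidTheory N
  open Freeing N B
  open Split {s} {t}

  Nᶠ : Matroid t
  Nᶠ = freeing N B

  ρ₁ ρ₂ ρ : Subset s → Subset t → ℕ
  ρ₁ X Y = rank M X + rank Nᶠ Y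
  ρ₂ X Y = rank M (X ∪ A) + rank N Y
  ρ  X Y = ρ₁ X Y ⊓ ρ₂ X Y

  ρ≤∣∣+∣∣ : ∀ X Y → ρ X Y ≤ ∣ X ∣ + ∣ Y ∣
  ρ≤∣∣+∣∣ X Y = ≤-trans (m⊓n≤m _ _) (+-mono-≤ (rank-≤ M X) (rank-≤ Nᶠ Y))

  ρ-mono : ∀ {X X′ Y Y′} → X ⊆ X′ → Y ⊆ Y′ → ρ X Y ≤ ρ X′ Y′
  ρ-mono {X} {X′} {Y} {Y′} X⊆X′ Y⊆Y′ =
    ⊓-mono-≤ (+-mono-≤ (M.r-mono X⊆X′) (rank-mono Nᶠ Y Y′ Y⊆Y′))
             (+-mono-≤ (M.r-mono (∪-mono X⊆X′ ⊆-refl)) (N.r-mono Y⊆Y′))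

  ρ₁-submodular : ∀ X X′ Y Y′ → ρ₁ (X ∪ X′) (Y ∪ Y′) + ρ₁ (X ∩ X′) (Y ∩ Y′) ≤ ρ₁ X Y + ρ₁ X′ Y′
  ρ₁-submodular X X′ Y Y′ =
    +-mono-≤-interchange
      (rank M (X ∪ X′)) (rank M (X ∩ X′)) (rank M X) (rank M X′)
      (rank Nᶠ (Y ∪ Y′)) (rank Nᶠ (Y ∩ Y′)) (rank Nᶠ Y) (rank Nᶠ Y′)
      (rank-sub M X X′) (rank-sub Nᶠ Y Y′)

  ρ₂-submodular : ∀ X X′ Y Y′ → ρ₂ (X ∪ X′) (Y ∪ Y′) + ρ₂ (X ∩ X′) (Y ∩ Y′) ≤ ρ₂ X Y + ρ₂ X′ Y′
  ρ₂-submodular X X′ Y Y′ =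
    +-mono-≤-interchange
      (rank M ((X ∪ X′) ∪ A)) (rank M ((X ∩ X′) ∪ A)) (rank M (X ∪ A)) (rank M (X′ ∪ A))
      (rank N (Y ∪ Y′)) (rank N (Y ∩ Y′)) (rank N Y) (rank N Y′)
      (M.r-submodular (X ∪ A) (X′ ∪ A)
        (∪-lub (∪-mono (p⊆p∪q A) (p⊆p∪q A)) (λ a∈A → p⊆p∪q (X′ ∪ A) (q⊆p∪q X A a∈A)))
        (∩-glb (∪-mono (p∩q⊆p X X′) ⊆-refl) (∪-mono (p∩q⊆q X X′) ⊆-refl)))
      (rank-sub N Y Y′)

  ρ₁-ρ₂-increment : ∀ {X X′ Y Y′} → X ⊆ X′ → Y ⊆ Y′ → ρ₁ X Y + ρ₂ X′ Y′ ≤ ρ₁ X′ Y′ + ρ₂ X Y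
  ρ₁-ρ₂-increment {X} {X′} {Y} {Y′} X⊆X′ Y⊆Y′ =
    +-mono-≤-interchange
      (rank M X) (rank M (X′ ∪ A)) (rank M X′) (rank M (X ∪ A))
      (rank Nᶠ Y) (rank N Y′) (rank Nᶠ Y′) (rank N Y)
      (M.r-increment-∪ A X⊆X′) (rank-freeing-increment Y⊆Y′)

  ρ-submodular : ∀ X X′ Y Y′ → ρ (X ∪ X′) (Y ∪ Y′) + ρ (X ∩ X′) (Y ∩ Y′) ≤ ρ X Y + ρ X′ Y′
  ρ-submodular X X′ Y Y′ =
    ⊓-submodular
      (ρ₁ (X ∪ X′) (Y ∪ Y′)) (ρ₁ (X ∩ X′) (Y ∩ Y′)) (ρ₁ X Y) (ρ₁ X′ Y′)
      (ρ₂ (X ∪ X′) (Y ∪ Y′)) (ρ₂ (X ∩ X′) (Y ∩ Y′)) (ρ₂ X Y) (ρ₂ X′ Y′)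
      (ρ₁-submodular X X′ Y Y′) (ρ₂-submodular X X′ Y Y′)
      (ρ₁-ρ₂-increment (p⊆p∪q X′) (p⊆p∪q Y′)) (ρ₁-ρ₂-increment (q⊆p∪q X X′) (q⊆p∪q Y Y′))

  P : Matroid (s + t)
  P = record
    { rank      = λ W → ρ (take s W) (drop s W)
    ; rank-≤    = λ W → ≤-trans (ρ≤∣∣+∣∣ (take s W) (drop s W)) (≤-reflexive (sym (∣split∣ W)))
    ; rank-mono = λ W V W⊆V → ρ-mono (proj₁ (split-⊆ W⊆V)) (proj₂ (split-⊆ W⊆V))
    ; rank-sub  = rank-sub-P
    }
    where
    rank-sub-P : ∀ W V → ρ (take s (W ∪ V)) (drop s (W ∪ V)) + ρ (take s (W ∩ V)) (drop s (W ∩ V))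
                         ≤ ρ (take s W) (drop s W) + ρ (take s V) (drop s V)
    rank-sub-P W V rewrite take-∪ W V | drop-∪ W V | take-∩ W V | drop-∩ W V =
      ρ-submodular (take s W) (take s V) (drop s W) (drop s V)

  rank-P-++ : ∀ X Y → rank P (X ++ Y) ≡ ρ X Y
  rank-P-++ X Y = cong₂ ρ (take-++ X Y) (drop-++ X Y)

  M⁺-independent⇔ : ∀ {X Y} → IndependentM⁺ M A B X Y ⇔
                    (Independent M X × Y ⊆ B × ∣ X ∣ + ∣ Y ∣ ≤ rank M (X ∪ A))
  M⁺-independent⇔ {X} {Y} = mk⇔ to from
    where
    to : IndependentM⁺ M A B X Y → Independent M X × Y ⊆ B × ∣ X ∣ + ∣ Y ∣ ≤ rank M (X ∪ A)
    to indM⁺ = proj₁ tight , Y⊆B , ≤-trans (≤-reflexive (sym indM⁺)) (m⊓n≤m _ _)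
      where
      tight : rank M X ≡ ∣ X ∣ × ∣ Y ∩ B ∣ ≡ ∣ Y ∣
      tight = +-tight (rank-≤ M X) (∣p∩q∣≤∣p∣ Y B) (≤-trans (≤-reflexive (sym indM⁺)) (m⊓n≤n _ _))
      Y∩B≡Y : Y ∩ B ≡ Y
      Y∩B≡Y = ⊆∧∣∣≥⇒≡ (p∩q⊆p Y B) (≤-reflexive (sym (proj₂ tight)))
      Y⊆B : Y ⊆ B
      Y⊆B y∈Y = p∩q⊆q Y B (subst (_ ∈_) (sym Y∩B≡Y) y∈Y)
    from : Independent M X × Y ⊆ B × ∣ X ∣ + ∣ Y ∣ ≤ rank M (X ∪ A) → IndependentM⁺ M A B X Y
    from (indX , Y⊆B , size≤) =
      ≤-antisym (≤-trans (m⊓n≤n _ _) (+-mono-≤ (rank-≤ M X) (∣p∩q∣≤∣p∣ Y B)))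
                (⊓-glb size≤ (≤-reflexive (cong₂ _+_ (sym indX) (cong ∣_∣ (sym Y∩B≡Y)))))
      where
      Y∩B≡Y : Y ∩ B ≡ Y
      Y∩B≡Y = ⊆-antisym (p∩q⊆p Y B) (∩-glb ⊆-refl Y⊆B)

  ρ-independent⇔ : ∀ {X Y} → ρ X Y ≡ ∣ X ∣ + ∣ Y ∣ ⇔
                   (Independent M X × Independent Nᶠ Y × ∣ X ∣ + ∣ Y ∣ ≤ ρ₂ X Y)
  ρ-independent⇔ {X} {Y} = mk⇔ to from
    where
    to : ρ X Y ≡ ∣ X ∣ + ∣ Y ∣ → Independent M X × Independent Nᶠ Y × ∣ X ∣ + ∣ Y ∣ ≤ ρ₂ X Y
    to indρ = proj₁ tight , proj₂ tight , ≤-trans (≤-reflexive (sym indρ)) (m⊓n≤n _ _)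
      where
      tight : Independent M X × Independent Nᶠ Y
      tight = +-tight (rank-≤ M X) (rank-≤ Nᶠ Y) (≤-trans (≤-reflexive (sym indρ)) (m⊓n≤m _ _))
    from : Independent M X × Independent Nᶠ Y × ∣ X ∣ + ∣ Y ∣ ≤ ρ₂ X Y → ρ X Y ≡ ∣ X ∣ + ∣ Y ∣
    from (indX , indᶠY , size≤ρ₂) =
      ≤-antisym (ρ≤∣∣+∣∣ X Y) (⊓-glb (≤-reflexive (sym (cong₂ _+_ indX indᶠY))) size≤ρ₂)

  independent-union : ∀ {X₁ Y₁ Y₂} → IndependentM⁺ M A B X₁ Y₁ → Independent N Y₂ →
                      ρ X₁ (Y₁ ∪ Y₂) ≡ ∣ X₁ ∣ + ∣ Y₁ ∪ Y₂ ∣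
  independent-union {X₁} {Y₁} {Y₂} indM⁺ indY₂ =
    Equivalence.from ρ-independent⇔ (indX₁ , Equivalence.from freeing-independent⇔ indY─B , size≤ρ₂)
    where
    open ≤-Reasoning
    Y : Subset t
    Y = Y₁ ∪ Y₂
    parts : Independent M X₁ × Y₁ ⊆ B × ∣ X₁ ∣ + ∣ Y₁ ∣ ≤ rank M (X₁ ∪ A)
    parts = Equivalence.to M⁺-independent⇔ indM⁺
    indX₁ : Independent M X₁
    indX₁ = proj₁ parts
    Y₁⊆B : Y₁ ⊆ B
    Y₁⊆B = proj₁ (proj₂ parts)
    Y─B⊆Y₂ : Y ─ B ⊆ Y₂
    Y─B⊆Y₂ {x} x∈ with x∈p∪q⁻ Y₁ Y₂ (p─q⊆p Y B x∈)
    ... | inj₁ x∈Y₁ = contradiction (Y₁⊆B x∈Y₁) (x∈p─q⇒x∉q Y B x∈)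
    ... | inj₂ x∈Y₂ = x∈Y₂
    indY─B : Independent N (Y ─ B)
    indY─B = N.independent-⊆ indY₂ Y─B⊆Y₂
    size≤ρ₂ : ∣ X₁ ∣ + ∣ Y ∣ ≤ ρ₂ X₁ Y
    size≤ρ₂ = begin
      ∣ X₁ ∣ + ∣ Y ∣                 ≤⟨ +-monoʳ-≤ ∣ X₁ ∣ (∣p∪q∣≤∣p∣+∣q∣ Y₁ Y₂) ⟩
      ∣ X₁ ∣ + (∣ Y₁ ∣ + ∣ Y₂ ∣)     ≡⟨ +-assoc ∣ X₁ ∣ _ _ ⟨
      (∣ X₁ ∣ + ∣ Y₁ ∣) + ∣ Y₂ ∣     ≤⟨ +-mono-≤ (proj₂ (proj₂ parts)) (≤-reflexive (sym indY₂)) ⟩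
      rank M (X₁ ∪ A) + rank N Y₂   ≤⟨ +-monoʳ-≤ (rank M (X₁ ∪ A)) (N.r-mono (q⊆p∪q Y₁ Y₂)) ⟩
      rank M (X₁ ∪ A) + rank N Y    ∎

  -- Conversely an independent set X ∪ Y of P splits: extend Y ─ B to a basis J of
  -- Y in N; then X ∪ (Y ─ J) is independent in M⁺(A,B) and J in N₀.
  independent-decompose : ∀ {X Y} → ρ X Y ≡ ∣ X ∣ + ∣ Y ∣ → IndependentPrincipalSum M N A B (X ++ Y)
  independent-decompose {X} {Y} indρ with Equivalence.to ρ-independent⇔ indρ
  ... | indX , indᶠY , size≤ρ₂
    with N.extend-to-basis (Equivalence.to freeing-independent⇔ indᶠY) (p─q⊆p Y B)
  ... | J , Y─B⊆J , J⊆Y , indJ , rJ≡rY =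
    X , Y ─ J , ⊥ , J , Equivalence.from M⁺-independent⇔ (indX , Y─J⊆B , size≤) , (refl , indJ) ,
    cong₂ _++_ (sym (∪-identityʳ X)) Y≡[Y─J]∪J
    where
    open ≤-Reasoning
    Y─J⊆B : Y ─ J ⊆ B
    Y─J⊆B {x} x∈ with x ∈? B
    ... | yes x∈B = x∈B
    ... | no  x∉B = contradiction (Y─B⊆J (x∈p∧x∉q⇒x∈p─q (p─q⊆p Y J x∈) x∉B)) (x∈p─q⇒x∉q Y J x∈)
    size≤ : ∣ X ∣ + ∣ Y ─ J ∣ ≤ rank M (X ∪ A)
    size≤ = +-cancelʳ-≤ (rank N Y) _ _ (begin
      (∣ X ∣ + ∣ Y ─ J ∣) + rank N Y  ≡⟨ cong ((∣ X ∣ + ∣ Y ─ J ∣) +_) (trans (sym rJ≡rY) indJ) ⟩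
      (∣ X ∣ + ∣ Y ─ J ∣) + ∣ J ∣     ≡⟨ rearrange (∣ X ∣) (∣ Y ─ J ∣) (∣ J ∣) ⟩
      ∣ X ∣ + (∣ J ∣ + ∣ Y ─ J ∣)     ≡⟨ cong (∣ X ∣ +_) (∣q∣+∣p─q∣≡∣p∣ J⊆Y) ⟩
      ∣ X ∣ + ∣ Y ∣                   ≤⟨ size≤ρ₂ ⟩
      rank M (X ∪ A) + rank N Y       ∎)
      where
      rearrange : ∀ a b c → (a + b) + c ≡ a + (c + b)
      rearrange = solve-∀
    Y≡[Y─J]∪J : Y ≡ (Y ─ J) ∪ J
    Y≡[Y─J]∪J = ⊆-antisym (⊆-trans (p⊆q∪[p─q] Y J) (⊆-reflexive (∪-comm J (Y ─ J))))
                          (∪-lub (p─q⊆p Y J) J⊆Y)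

  independent-++⇔ : ∀ X Y → Independent P (X ++ Y) ⇔ ρ X Y ≡ ∣ X ∣ + ∣ Y ∣
  independent-++⇔ X Y = mk⇔
    (λ ind → trans (sym (rank-P-++ X Y)) (trans ind (∣p++q∣≡∣p∣+∣q∣ X Y)))
    (λ indρ → trans (rank-P-++ X Y) (trans indρ (sym (∣p++q∣≡∣p∣+∣q∣ X Y))))

  independent⇔ : ∀ W → IndependentPrincipalSum M N A B W ⇔ Independent P W
  independent⇔ W = mk⇔ to from
    where
    to : IndependentPrincipalSum M N A B W → Independent P W
    to (X₁ , Y₁ , _ , Y₂ , indM⁺ , (refl , indY₂) , refl) =
      Equivalence.from (independent-++⇔ (X₁ ∪ ⊥) (Y₁ ∪ Y₂))
        (subst (λ X → ρ X (Y₁ ∪ Y₂) ≡ ∣ X ∣ + ∣ Y₁ ∪ Y₂ ∣) (sym (∪-identityʳ X₁))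
               (independent-union indM⁺ indY₂))
    from : Independent P W → IndependentPrincipalSum M N A B W
    from indW = subst (IndependentPrincipalSum M N A B) (split W)
      (independent-decompose (Equivalence.to (independent-++⇔ (take s W) (drop s W))
                                             (subst (Independent P) (sym (split W)) indW)))

  private module P = MatroidTheory P

  Stableˡ Stableʳ : Subset s → Subset t → Set
  Stableˡ X Y = ∀ i → i ∈ X → ρ (X - i) Y ≡ ρ X Y
  Stableʳ X Y = ∀ j → j ∈ Y → ρ X (Y - j) ≡ ρ X Y

  P-stable-++⇔ : ∀ X Y → P.RankStableUnderDeletion (X ++ Y) ⇔ (Stableˡ X Y × Stableʳ X Y)
  P-stable-++⇔ X Y = mk⇔ (λ stable → stableˡ stable , stableʳ stable) from
    where
    open ≡-Reasoning
    stableˡ : P.RankStableUnderDeletion (X ++ Y) → Stableˡ X Y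
    stableˡ stable i i∈X = begin
      ρ (X - i) Y                   ≡⟨ rank-P-++ (X - i) Y ⟨
      rank P ((X - i) ++ Y)         ≡⟨ cong (rank P) (++-─-↑ˡ X Y i) ⟨
      rank P ((X ++ Y) - (i ↑ˡ t))  ≡⟨ stable (i ↑ˡ t) (↑ˡ∈++⁺ i∈X) ⟩
      rank P (X ++ Y)               ≡⟨ rank-P-++ X Y ⟩
      ρ X Y                         ∎
    stableʳ : P.RankStableUnderDeletion (X ++ Y) → Stableʳ X Y
    stableʳ stable j j∈Y = begin
      ρ X (Y - j)                   ≡⟨ rank-P-++ X (Y - j) ⟨
      rank P (X ++ (Y - j))         ≡⟨ cong (rank P) (++-─-↑ʳ X Y j) ⟨
      rank P ((X ++ Y) - (s ↑ʳ j))  ≡⟨ stable (s ↑ʳ j) (↑ʳ∈++⁺ j∈Y) ⟩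
      rank P (X ++ Y)               ≡⟨ rank-P-++ X Y ⟩
      ρ X Y                         ∎
    from : Stableˡ X Y × Stableʳ X Y → P.RankStableUnderDeletion (X ++ Y)
    from (stableˡ , stableʳ) e e∈ with ↑-cases e
    ... | inj₁ (i , refl) = begin
      rank P ((X ++ Y) - (i ↑ˡ t))  ≡⟨ cong (rank P) (++-─-↑ˡ X Y i) ⟩
      rank P ((X - i) ++ Y)         ≡⟨ rank-P-++ (X - i) Y ⟩
      ρ (X - i) Y                   ≡⟨ stableˡ i (↑ˡ∈++⁻ e∈) ⟩
      ρ X Y                         ≡⟨ rank-P-++ X Y ⟨
      rank P (X ++ Y)               ∎
    ... | inj₂ (j , refl) = begin
      rank P ((X ++ Y) - (s ↑ʳ j))  ≡⟨ cong (rank P) (++-─-↑ʳ X Y j) ⟩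
      rank P (X ++ (Y - j))         ≡⟨ rank-P-++ X (Y - j) ⟩
      ρ X (Y - j)                   ≡⟨ stableʳ j (↑ʳ∈++⁻ e∈) ⟩
      ρ X Y                         ≡⟨ rank-P-++ X Y ⟨
      rank P (X ++ Y)               ∎

  cyclic⇔stable : ∀ X Y → Cyclic (IndependentPrincipalSum M N A B) (X ++ Y) ⇔ (Stableˡ X Y × Stableʳ X Y)
  cyclic⇔stable X Y =
    ⇔-trans (Cyclic-cong independent⇔ (X ++ Y))
            (⇔-trans (mk⇔ P.cyclic⇒stable P.stable⇒cyclic) (P-stable-++⇔ X Y))

  Condition₁ Condition₂ : Subset s → Subset t → Set
  Condition₁ X Y = CyclicIn M X × CyclicIn N Y × Empty (Y ∩ B)
  Condition₂ X Y = (∀ e → IsColoopOfRestriction M (X ∪ A) e → e ∈ A) × CyclicIn N Y ×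
                   rank M (X ∪ A) + rank N Y < rank M X + rank N (Y ─ B) + ∣ Y ∩ B ∣

  ρ₂<ρ₁⇔ : ∀ X Y → ρ₂ X Y < ρ₁ X Y ⇔ (rank M (X ∪ A) + rank N Y < rank M X + rank N (Y ─ B) + ∣ Y ∩ B ∣)
  ρ₂<ρ₁⇔ X Y = mk⇔ (λ lt → ≤-trans lt (≤-reflexive (sym assoc))) (λ lt → ≤-trans lt (≤-reflexive assoc))
    where
    assoc : rank M X + rank N (Y ─ B) + ∣ Y ∩ B ∣ ≡ ρ₁ X Y
    assoc = +-assoc (rank M X) (rank N (Y ─ B)) ∣ Y ∩ B ∣

  disjoint-⊆ : ∀ {Y Y′} → Y′ ⊆ Y → Empty (Y ∩ B) → Empty (Y′ ∩ B)
  disjoint-⊆ Y′⊆Y disjoint (x , x∈) = disjoint (x , ∩-mono Y′⊆Y ⊆-refl x∈)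

  -- Stability gives (2) when ρ₂ < ρ₁, since then ρ₂ itself must be stable; and
  -- (1) otherwise, since then ρ₁ must be stable, which an element of Y ∩ B
  -- would violate.
  stable⇒conditions : ∀ X Y → Stableˡ X Y × Stableʳ X Y → Condition₁ X Y ⊎ Condition₂ X Y
  stable⇒conditions X Y (stableˡ , stableʳ) with ρ₂ X Y <? ρ₁ X Y
  ... | yes ρ₂<ρ₁ = inj₂ (Equivalence.from (M.coloops-in⇔ X A) rank-kept , cyclicY ,
                          Equivalence.to (ρ₂<ρ₁⇔ X Y) ρ₂<ρ₁)
    where
    rank-kept : ∀ i → i ∈ X → rank M ((X - i) ∪ A) ≡ rank M (X ∪ A)
    rank-kept i i∈X = ≤-antisym (M.r-mono (∪-mono (p─q⊆p X ⁅ i ⁆) ⊆-refl))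
      (+-cancelʳ-≤ (rank N Y) _ _ (⊓-preserved⇒≤ʳ (stableˡ i i∈X) ρ₂<ρ₁))
    cyclicY : CyclicIn N Y
    cyclicY = N.stable⇒cyclic λ j j∈Y → ≤-antisym (N.r-mono (p─q⊆p Y ⁅ j ⁆))
      (+-cancelˡ-≤ (rank M (X ∪ A)) _ _ (⊓-preserved⇒≤ʳ (stableʳ j j∈Y) ρ₂<ρ₁))
  ... | no ρ₂≮ρ₁ = inj₁ (cyclicX , cyclicY , disjoint)
    where
    ρ₁≤ρ₂ : ρ₁ X Y ≤ ρ₂ X Y
    ρ₁≤ρ₂ = ≮⇒≥ ρ₂≮ρ₁
    rNᶠ-kept : ∀ j → j ∈ Y → rank Nᶠ Y ≤ rank Nᶠ (Y - j)
    rNᶠ-kept j j∈Y = +-cancelˡ-≤ (rank M X) _ _ (⊓-preserved⇒≤ˡ (stableʳ j j∈Y) ρ₁≤ρ₂)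
    disjoint : Empty (Y ∩ B)
    disjoint (j , j∈Y∩B) =
      <⇒≱ (rank-freeing-drop (p∩q⊆p Y B j∈Y∩B) (p∩q⊆q Y B j∈Y∩B)) (rNᶠ-kept j (p∩q⊆p Y B j∈Y∩B))
    cyclicX : CyclicIn M X
    cyclicX = M.stable⇒cyclic λ i i∈X → ≤-antisym (M.r-mono (p─q⊆p X ⁅ i ⁆))
      (+-cancelʳ-≤ (rank Nᶠ Y) _ _ (⊓-preserved⇒≤ˡ (stableˡ i i∈X) ρ₁≤ρ₂))
    cyclicY : CyclicIn N Y
    cyclicY = N.stable⇒cyclic λ j j∈Y → ≤-antisym (N.r-mono (p─q⊆p Y ⁅ j ⁆)) (begin
      rank N Y          ≡⟨ rank-freeing-disjoint disjoint ⟨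
      rank Nᶠ Y         ≤⟨ rNᶠ-kept j j∈Y ⟩
      rank Nᶠ (Y - j)   ≡⟨ rank-freeing-disjoint (disjoint-⊆ (p─q⊆p Y ⁅ j ⁆) disjoint) ⟩
      rank N (Y - j)    ∎)
      where open ≤-Reasoning

  -- Conversely, under (1) both ρ₁ and ρ₂ are stable; under (2) ρ₂ is stable and
  -- ρ₁, which exceeds ρ₂, drops by at most one.
  conditions⇒stable : ∀ X Y → Condition₁ X Y ⊎ Condition₂ X Y → Stableˡ X Y × Stableʳ X Y
  conditions⇒stable X Y (inj₁ (cyclicX , cyclicY , disjoint)) = stableˡ , stableʳ
    where
    stableˡ : Stableˡ X Y
    stableˡ i i∈X = cong₂ _⊓_ ρ₁-kept ρ₂-kept
      where
      ρ₁-kept : ρ₁ (X - i) Y ≡ ρ₁ X Y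
      ρ₁-kept = cong (_+ rank Nᶠ Y) (M.cyclic⇒stable cyclicX i i∈X)
      ρ₂-kept : ρ₂ (X - i) Y ≡ ρ₂ X Y
      ρ₂-kept = ≤-antisym (+-monoˡ-≤ (rank N Y) (M.r-mono (∪-mono (p─q⊆p X ⁅ i ⁆) ⊆-refl)))
        (+-cancelˡ-≤ (ρ₁ X Y) _ _ (≤-trans (≤-reflexive (cong (_+ ρ₂ X Y) (sym ρ₁-kept)))
                                           (ρ₁-ρ₂-increment (p─q⊆p X ⁅ i ⁆) ⊆-refl)))
    stableʳ : Stableʳ X Y
    stableʳ j j∈Y = cong₂ _⊓_ (cong (rank M X +_) rNᶠ-kept) (cong (rank M (X ∪ A) +_) rN-kept)
      where
      rN-kept : rank N (Y - j) ≡ rank N Y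
      rN-kept = N.cyclic⇒stable cyclicY j j∈Y
      rNᶠ-kept : rank Nᶠ (Y - j) ≡ rank Nᶠ Y
      rNᶠ-kept = begin
        rank Nᶠ (Y - j)  ≡⟨ rank-freeing-disjoint (disjoint-⊆ (p─q⊆p Y ⁅ j ⁆) disjoint) ⟩
        rank N (Y - j)   ≡⟨ rN-kept ⟩
        rank N Y         ≡⟨ rank-freeing-disjoint disjoint ⟨
        rank Nᶠ Y        ∎
        where open ≡-Reasoning
  conditions⇒stable X Y (inj₂ (coloops-in-A , cyclicY , inequality)) = stableˡ , stableʳ
    where
    ρ₂<ρ₁ : ρ₂ X Y < ρ₁ X Y
    ρ₂<ρ₁ = Equivalence.from (ρ₂<ρ₁⇔ X Y) inequality
    stableˡ : Stableˡ X Y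
    stableˡ i i∈X = ⊓-preserved ρ₂<ρ₁ (+-monoˡ-≤ (rank Nᶠ Y) (M.r≤1+r[p-x] X i))
      (cong (_+ rank N Y) (Equivalence.to (M.coloops-in⇔ X A) coloops-in-A i i∈X))
    stableʳ : Stableʳ X Y
    stableʳ j j∈Y = ⊓-preserved ρ₂<ρ₁
      (≤-trans (+-monoʳ-≤ (rank M X) (MatroidTheory.r≤1+r[p-x] Nᶠ Y j)) (≤-reflexive (+-suc _ _)))
      (cong (rank M (X ∪ A) +_) (N.cyclic⇒stable cyclicY j j∈Y))

theorem3p16 : ∀ {s t} (M : Matroid s) (N : Matroid t)
    (A : Subset s) (B : Subset t) (X : Subset s) (Y : Subset t) →
    Cyclic (IndependentPrincipalSum M N A B) (X ++ Y) ⇔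
    ((CyclicIn M X × CyclicIn N Y × Empty (Y ∩ B)) ⊎
     ((∀ e → IsColoopOfRestriction M (X ∪ A) e → e ∈ A) × CyclicIn N Y ×
      rank M (X ∪ A) + rank N Y < rank M X + rank N (Y ─ B) + ∣ Y ∩ B ∣))
theorem3p16 M N A B X Y =
  ⇔-trans (cyclic⇔stable X Y) (mk⇔ (stable⇒conditions X Y) (conditions⇒stable X Y))
  where open PrincipalSum M N A B
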